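{- Let $C$ be a 3-SAT instance and let $\mathrm{red}_{\rm EPS}(C)$ be the tuple of periods constructed in the context. If $\mathrm{red}_{\rm EPS}(C)$ has an EPS schedule, then $C$ is satisfiable.
   Context: A 3-SAT instance $C=\bigwedge_{j=1}^m C_j$ over variables $x_1,\ldots,x_n$ has clauses $C_j=c_{j1}\vee c_{j2}\vee c_{j3}$ of three distinct literals, and no clause contains both a variable and its negation. Construction $\mathrm{red}_{\rm EPS}(C)$: let $p_1<\cdots<p_{2n}$ be the first $2n$ primes greater than $\max(m,n)$; set $\mathrm{rep}_1(x_i)=p_{2i-1}$, $\mathrm{rep}_1(\bar x_i)=p_{2i}$. The output list consists of: for each of the $2n$ literals $y$, exactly $\mathrm{rep}_1(y)^2-\mathrm{rep}_1(y)$ copies of the period $2n\,\mathrm{rep}_1(y)^2$; for each $i\in[n]$ one period $f_i=2n\,\mathrm{rep}_1(x_i)\,\mathrm{rep}_1(\bar x_i)$; for each clause $C_j$ one period $2n\,(\mathrm{rep}_1(c_{j1})\mathrm{rep}_1(c_{j2})\mathrm{rep}_1(c_{j3}))^2$. An EPS schedule for a tuple $(a_1,\ldots,a_k)$ is a map $\sigma:\mathbb{Z}\to\{1,\ldots,k\}\cup\{\bot\}$ such that for each task $i$, $\sigma^{ -1}(\{i\})$ is nonempty and consecutive occurrences of task $i$ are exactly $a_i$ apart. -}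

module Defs where

open import Data.Nat using (ℕ; zero; suc; _+_; _*_; _∸_; _<_; _⊔_)
open import Data.Nat.Primality using (Prime)
open import Data.Fin using (Fin; toℕ)
open import Data.Bool using (Bool; true; false; if_then_else_; T)
open import Data.Product using (Σ; ∃; _×_; _,_; proj₁; proj₂)
open import Data.List using (List; []; _∷_; _++_; map; concatMap; replicate; length; lookup; allFin)
open import Data.Maybe using (Maybe; just)
open import Data.Integer as ℤ using (ℤ; +_)
open import Relation.Binary.PropositionalEquality using (_≡_; _≢_)
open import Relation.Nullary using (¬_)

-- A literal over variables x_0 … x_{n-1}: (i , true) is x_i, (i , false) is ¬x_i.
Literal : ℕ → Set
Literal n = Fin n × Bool

record Clause (n : ℕ) : Set where
  field
    c₁ c₂ c₃ : Literal n
    distinct₁₂ : c₁ ≢ c₂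
    distinct₁₃ : c₁ ≢ c₃
    distinct₂₃ : c₂ ≢ c₃
    noCompl₁₂ : proj₁ c₁ ≡ proj₁ c₂ → proj₂ c₁ ≡ proj₂ c₂
    noCompl₁₃ : proj₁ c₁ ≡ proj₁ c₃ → proj₂ c₁ ≡ proj₂ c₃
    noCompl₂₃ : proj₁ c₂ ≡ proj₁ c₃ → proj₂ c₂ ≡ proj₂ c₃
open Clause public

Instance : ℕ → ℕ → Set
Instance n m = Fin m → Clause n

litValue : ∀ {n} → (Fin n → Bool) → Literal n → Bool
litValue α (i , true)  = α i
litValue α (i , false) = if α i then false else true

ClauseSat : ∀ {n} → (Fin n → Bool) → Clause n → Set
ClauseSat α c = T (litValue α (c₁ c)) Data.Sum.⊎ (T (litValue α (c₂ c)) Data.Sum.⊎ T (litValue α (c₃ c)))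
  where import Data.Sum

Satisfiable : ∀ {n m} → Instance n m → Set
Satisfiable {n} {m} C = Σ (Fin n → Bool) λ α → (j : Fin m) → ClauseSat α (C j)

-- The primes p_1 < … < p_{2n}: first 2n primes greater than B = max(m,n).
-- Represented 0-indexed as p 0 < p 1 < … < p (2n-1).

record FirstPrimesAbove (B k : ℕ) (p : ℕ → ℕ) : Set where
  field
    prime   : ∀ j → j < k → Prime (p j)
    above   : ∀ j → j < k → B < p j
    incr    : ∀ j → suc j < k → p j < p (suc j)
    noSkip  : ∀ j q → j < k → Prime q → B < q → q < p j →
              Σ ℕ λ j' → (j' < j) × (p j' ≡ q)
open FirstPrimesAbove public

-- rep₁(x_i) = p_{2i-1}, rep₁(¬x_i) = p_{2i}  (here 0-indexed: p(2i), p(2i+1))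
rep₁ : ∀ {n} → (ℕ → ℕ) → Literal n → ℕ
rep₁ p (i , true)  = p (2 * toℕ i)
rep₁ p (i , false) = p (suc (2 * toℕ i))

allLiterals : (n : ℕ) → List (Literal n)
allLiterals n = concatMap (λ i → (i , true) ∷ (i , false) ∷ []) (allFin n)

redEPS : ∀ {n m} → (ℕ → ℕ) → Instance n m → List ℕ
redEPS {n} {m} p C =
     concatMap (λ y → let r = rep₁ p y in replicate (r * r ∸ r) (2 * n * (r * r)))
               (allLiterals n)
  ++ map (λ i → 2 * n * (rep₁ p (i , true) * rep₁ p (i , false))) (allFin n)
  ++ map (λ j → let c = C j
                    q = rep₁ p (c₁ c) * rep₁ p (c₂ c) * rep₁ p (c₃ c)
                in 2 * n * (q * q)) (allFin m)

-- σ : ℤ → {tasks} ∪ {⊥}, with tasks Fin (length a) and ⊥ = nothing.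
IsEPSSchedule : (a : List ℕ) → (ℤ → Maybe (Fin (length a))) → Set
IsEPSSchedule a σ = (i : Fin (length a)) →
    (Σ ℤ λ t → σ t ≡ just i)
  × (∀ t → σ t ≡ just i →
        (σ (t ℤ.+ + lookup a i) ≡ just i)
      × (σ (t ℤ.- + lookup a i) ≡ just i)
      × (∀ d → 0 < d → d < lookup a i → σ (t ℤ.+ + d) ≢ just i))

HasEPSSchedule : List ℕ → Set
HasEPSSchedule a = Σ (ℤ → Maybe (Fin (length a))) (IsEPSSchedule a)

module Submission where

-- Write N = 2n and r_y for the prime of a literal y.  If two tasks have periods N u and N v
-- with u, v coprime and start times congruent mod N, Bézout makes their progressions of
-- occurrences meet, so the tasks coincide.  Hence the 2n literal tasks (periods N r_y²) fill
-- the N residue classes mod N, every copy of a literal lies in that literal's class, and the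
-- task of period N r_x r_¬x lies in the class of x or of ¬x; this yields the assignment.
-- If y is false, its class would hold the r² − r copies of y (period N r²), the variable task
-- (period N r s with s coprime to r, blocking the r residues mod N r² congruent to its start
-- mod N r) and any clause task containing y (period N r² w², w > 1): r² + 1 pairwise distinct
-- residues mod N r² inside one class mod N, which has only r² of them.  A clause task lies in
-- the class of some literal, which must occur in the clause and is therefore true.

open import Defs

open import Data.Bool using (Bool; true; false; not; T)
import Data.Bool as Bool
import Data.Bool.Properties as Bool
open import Data.Empty using (⊥; ⊥-elim)
open import Data.Fin as Fin using (Fin; toℕ; combine; punchOut)
import Data.Fin.Properties as Fin
open import Data.Integer as ℤ using (ℤ; +_; -[1+_])
import Data.Integer.Properties as ℤ
open import Data.List using (List; []; _∷_; _++_; length; lookup; concatMap; replicate; map; allFin)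
open import Data.List.Membership.Propositional using (_∈_)
open import Data.List.Membership.Propositional.Properties using (∈-concatMap⁺; ∈-map⁺; ∈-allFin)
open import Data.List.Properties using (length-replicate; lookup-replicate)
open import Data.List.Relation.Binary.Sublist.Propositional using (_⊆_; _∷_; _∷ʳ_; ⊆-refl; from∈)
open import Data.List.Relation.Binary.Sublist.Propositional.Properties using (++⁺ˡ; ++⁺ʳ)
import Data.List.Relation.Unary.Any as Any
open import Data.List.Relation.Unary.Any using (here; there)
open import Data.Maybe using (Maybe; just)
open import Data.Maybe.Properties using (just-injective)
open import Data.Nat using (ℕ; _*_; _⊔_)
open import Data.Nat as ℕ using (zero; suc; _+_; _∸_; _<_; _≤_; s≤s; NonZero; _%_; _/_)
import Data.Nat.Properties as ℕ
open import Data.Nat.Coprimality as Coprime using (Coprime; coprime-Bézout)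
open import Data.Nat.Divisibility using (_∣_; divides; n∣m*n; m∣m*n; ∣m⇒∣m*n; ∣-refl; ∣-reflexive)
open import Data.Nat.DivMod using (_mod_; m≡m%n+[m/n]*n; m∣n⇒o%n%m≡o%m; m%[n*o]/o≡m/o%n; [m+kn]%n≡m%n)
open import Data.Nat.GCD using (module Bézout)
open import Data.Nat.Primality using (Prime; prime⇒irreducible; prime⇒nonTrivial)
open import Data.Nat.Tactic.RingSolver using (solve; solve-∀)
open import Data.Product using (∃; ∃₂; _,_; proj₁; proj₂)
open import Data.Product.Properties using (≡-dec)
open import Data.Sum using (_⊎_; inj₁; inj₂)
open import Data.Unit using (tt)
open import Function using (_∘_)
open import Function.Definitions using (Injective)
open import Relation.Binary.Definitions using (tri<; tri≈; tri>)
open import Relation.Binary.PropositionalEquality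
open import Relation.Nullary using (¬_; contradiction; yes; no)
open import Relation.Nullary.Decidable using (Dec; isYes)

open import Algebra.Properties.CommutativeSemigroup ℕ.*-commutativeSemigroup
  using (xy∙z≈y∙xz; xy∙z≈z∙xy; x∙yz≈xz∙y)

module _ {g : ℕ} .{{_ : NonZero g}} where

  private
    quotient-offset : ∀ {x y} → x % g ≡ y % g → x / g ≤ y / g → y ≡ x + (y / g ∸ x / g) * g
    quotient-offset {x} {y} x≡y x/g≤y/g = begin
      y                            ≡⟨ m≡m%n+[m/n]*n y g ⟩
      y % g + y / g * g            ≡⟨ cong₂ (λ r q → r + q * g) (sym x≡y) (sym (ℕ.m+[n∸m]≡n x/g≤y/g)) ⟩
      x % g + (x / g + d) * g      ≡⟨ cong (λ q → x % g + q) (ℕ.*-distribʳ-+ g (x / g) d) ⟩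
      x % g + (x / g * g + d * g)  ≡⟨ ℕ.+-assoc (x % g) _ _ ⟨
      (x % g + x / g * g) + d * g  ≡⟨ cong (_+ d * g) (m≡m%n+[m/n]*n x g) ⟨
      x + d * g                    ∎
      where
      open ≡-Reasoning
      d = y / g ∸ x / g

  %≡%⇒≡+* : ∀ {x y} → x % g ≡ y % g → ∃ λ δ → y ≡ x + δ * g ⊎ x ≡ y + δ * g
  %≡%⇒≡+* {x} {y} x≡y with ℕ.≤-total (x / g) (y / g)
  ... | inj₁ x/g≤y/g = y / g ∸ x / g , inj₁ (quotient-offset x≡y x/g≤y/g)
  ... | inj₂ y/g≤x/g = x / g ∸ y / g , inj₂ (quotient-offset (sym x≡y) y/g≤x/g)

  progressions-meet : ∀ {a b u v} δ → Coprime u v → 0 < u → b ≡ a + δ * g →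
                      ∃₂ λ k l → a + k * (g * u) ≡ b + l * (g * v)
  progressions-meet {a} {u = u@(suc u′)} {v} δ u⊥v _ refl with coprime-Bézout u⊥v
  ... | Bézout.+- x y 1+yv≡xu = δ * x , δ * y , (begin
    a + δ * x * (g * u)            ≡⟨ solve (a ∷ δ ∷ x ∷ g ∷ u′ ∷ []) ⟩
    a + δ * g * (x * u)            ≡⟨ cong (λ z → a + δ * g * z) 1+yv≡xu ⟨
    a + δ * g * (1 + y * v)        ≡⟨ solve (a ∷ δ ∷ g ∷ y ∷ v ∷ []) ⟩
    a + δ * g + δ * y * (g * v)    ∎)
    where open ≡-Reasoning
  ... | Bézout.-+ x y 1+xu≡yv = δ + δ * u′ * x , δ * u′ * y , (begin
    a + (δ + δ * u′ * x) * (g * suc u′)         ≡⟨ solve (a ∷ δ ∷ u′ ∷ x ∷ g ∷ []) ⟩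
    a + δ * g + δ * u′ * g * (1 + x * suc u′)   ≡⟨ cong (λ z → a + δ * g + δ * u′ * g * z) 1+xu≡yv ⟩
    a + δ * g + δ * u′ * g * (y * v)            ≡⟨ solve (a ∷ δ ∷ g ∷ u′ ∷ y ∷ v ∷ []) ⟩
    a + δ * g + δ * u′ * y * (g * v)            ∎)
    where open ≡-Reasoning

  %≡%⇒progressions-meet : ∀ {a b u v} → Coprime u v → 0 < u → 0 < v → a % g ≡ b % g →
                          ∃₂ λ k l → a + k * (g * u) ≡ b + l * (g * v)
  %≡%⇒progressions-meet u⊥v u>0 v>0 a≡b with %≡%⇒≡+* a≡b
  ... | δ , inj₁ b≡a+δg = progressions-meet δ u⊥v u>0 b≡a+δg
  ... | δ , inj₂ a≡b+δg with k , l , eq ← progressions-meet δ (Coprime.sym u⊥v) v>0 a≡b+δg = l , k , sym eq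

%≡%⇒%≡%-∣ : ∀ {d g x y} .{{_ : NonZero d}} .{{_ : NonZero g}} → d ∣ g → x % g ≡ y % g → x % d ≡ y % d
%≡%⇒%≡%-∣ {d} {g} {x} {y} d∣g x≡y = begin
  x % d      ≡⟨ m∣n⇒o%n%m≡o%m d g x d∣g ⟨
  x % g % d  ≡⟨ cong (_% d) x≡y ⟩
  y % g % d  ≡⟨ m∣n⇒o%n%m≡o%m d g y d∣g ⟩
  y % d      ∎
  where open ≡-Reasoning

module _ {N R : ℕ} .{{_ : NonZero N}} .{{_ : NonZero R}} where

  private instance
    R*N≢0 : NonZero (R * N)
    R*N≢0 = ℕ.m*n≢0 R N

  %[R*N]≡%N+/N%R*N : ∀ x → x % (R * N) ≡ x % N + x / N % R * N
  %[R*N]≡%N+/N%R*N x = begin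
    x % (R * N)                                ≡⟨ m≡m%n+[m/n]*n (x % (R * N)) N ⟩
    x % (R * N) % N + x % (R * N) / N * N      ≡⟨ cong₂ (λ r q → r + q * N)
                                                    (m∣n⇒o%n%m≡o%m N (R * N) x (n∣m*n R))
                                                    (m%[n*o]/o≡m/o%n x R N) ⟩
    x % N + x / N % R * N                      ∎
    where open ≡-Reasoning

  %≡%∧/%≡/%⇒%≡% : ∀ {x y} → x % N ≡ y % N → x / N % R ≡ y / N % R → x % (R * N) ≡ y % (R * N)
  %≡%∧/%≡/%⇒%≡% {x} {y} x≡y x/N≡y/N = begin
    x % (R * N)            ≡⟨ %[R*N]≡%N+/N%R*N x ⟩
    x % N + x / N % R * N  ≡⟨ cong₂ (λ r q → r + q * N) x≡y x/N≡y/N ⟩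
    y % N + y / N % R * N  ≡⟨ %[R*N]≡%N+/N%R*N y ⟨
    y % (R * N)            ∎
    where open ≡-Reasoning

≡+*⇒≡ : ∀ {i j r} δ → j ≡ i + δ * r → j < r → j ≡ i
≡+*⇒≡ zero    j≡i+0 _   = trans j≡i+0 (ℕ.+-identityʳ _)
≡+*⇒≡ {i} {j} {r} (suc δ) refl j<r = contradiction j<r (ℕ.≤⇒≯ (begin
  r                    ≤⟨ ℕ.m≤m+n r (δ * r) ⟩
  r + δ * r            ≤⟨ ℕ.m≤n+m (r + δ * r) i ⟩
  i + (r + δ * r)      ∎))
  where open ℕ.≤-Reasoning

module _ {d r : ℕ} .{{_ : NonZero d}} .{{_ : NonZero r}} where

  private instance
    d*r≢0 : NonZero (d * r)
    d*r≢0 = ℕ.m*n≢0 d r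

  +-*-offset : ∀ {x i j} δ → x + j * d ≡ x + i * d + δ * (d * r) → j ≡ i + δ * r
  +-*-offset {x} {i} {j} δ eq =
    ℕ.*-cancelʳ-≡ j (i + δ * r) d (ℕ.+-cancelˡ-≡ x _ _ (trans eq (solve (x ∷ i ∷ d ∷ δ ∷ r ∷ []))))

  +-*-%-injective : ∀ {x i j} → i < r → j < r → (x + i * d) % (d * r) ≡ (x + j * d) % (d * r) → i ≡ j
  +-*-%-injective i<r j<r eq with %≡%⇒≡+* {d * r} eq
  ... | δ , inj₁ e = sym (≡+*⇒≡ δ (+-*-offset δ e) j<r)
  ... | δ , inj₂ e = ≡+*⇒≡ δ (+-*-offset δ e) i<r

*-positive : ∀ {x y} → 0 < x → 0 < y → 0 < x * y
*-positive {suc x} {suc y} _ _ = ℕ.z<s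

*-nontrivial : ∀ {x y} → 1 < x → 0 < y → 1 < x * y
*-nontrivial {x} {suc y} 1<x _ = ℕ.<-≤-trans 1<x (ℕ.m≤m*n x (suc y))

coprime-*ˡ : ∀ {x y z} → Coprime x z → Coprime y z → Coprime (x * y) z
coprime-*ˡ {y = y} x⊥z y⊥z (d∣xy , d∣z) =
  y⊥z (Coprime.coprime-factors x⊥z (d∣xy , ∣m⇒∣m*n y d∣z) , d∣z)

coprime-*ʳ : ∀ {x y z} → Coprime x y → Coprime x z → Coprime x (y * z)
coprime-*ʳ x⊥y x⊥z = Coprime.sym (coprime-*ˡ (Coprime.sym x⊥y) (Coprime.sym x⊥z))

coprime-squares : ∀ {x y} → Coprime x y → Coprime (x * x) (y * y)
coprime-squares x⊥y = coprime-*ˡ (coprime-*ʳ x⊥y x⊥y) (coprime-*ʳ x⊥y x⊥y)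

primes-coprime : ∀ {p q} → Prime p → Prime q → p ≢ q → Coprime p q
primes-coprime p-prime q-prime p≢q (d∣p , d∣q)
  with prime⇒irreducible p-prime d∣p | prime⇒irreducible q-prime d∣q
... | inj₁ d≡1 | _        = d≡1
... | inj₂ _   | inj₁ d≡1 = d≡1
... | inj₂ d≡p | inj₂ d≡q = contradiction (trans (sym d≡p) d≡q) p≢q

injective⇒surjective : ∀ {m k} (f : Fin m → Fin k) → Injective _≡_ _≡_ f → k ≤ m →
                       ∀ j → ∃ λ i → f i ≡ j
injective⇒surjective {m} {suc k} f f-injective k<m j with Fin.any? (λ i → f i Fin.≟ j)
... | yes hit = hit
... | no  miss = ⊥-elim (Fin.<⇒notInjective k<m f-without-j-injective)
  where
  j≢f : ∀ i → j ≢ f i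
  j≢f i j≡fi = miss (i , sym j≡fi)
  f-without-j-injective : Injective _≡_ _≡_ (λ i → punchOut (j≢f i))
  f-without-j-injective {i} {i′} eq = f-injective (Fin.punchOut-injective (j≢f i) (j≢f i′) eq)

module _ {A : Set} {m} (g : A → Fin m) (g-surjective : ∀ i → ∃ λ x → g x ≡ i) where

  private
    section : Fin m → A
    section i = proj₁ (g-surjective i)

    section-injective : Injective _≡_ _≡_ section
    section-injective {i} {i′} eq =
      trans (sym (proj₂ (g-surjective i))) (trans (cong g eq) (proj₂ (g-surjective i′)))

  injective⇒surjective-via : ∀ {k} (f : A → Fin k) → Injective _≡_ _≡_ f → k ≤ m →
                             ∀ j → ∃ λ x → f x ≡ j
  injective⇒surjective-via f f-injective k≤m j
    with i , f[section[i]]≡j ← injective⇒surjective (f ∘ section) (section-injective ∘ f-injective) k≤m j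
    = section i , f[section[i]]≡j

⊎-<⇒notInjective : ∀ {a b k} {f : Fin a ⊎ Fin b → Fin k} → k < a + b → ¬ Injective _≡_ _≡_ f
⊎-<⇒notInjective {a} {b} {f = f} k<a+b f-injective =
  Fin.<⇒notInjective {f = f ∘ Fin.splitAt a} k<a+b λ {i} {j} eq → begin
    i                              ≡⟨ Fin.join-splitAt a b i ⟨
    Fin.join a b (Fin.splitAt a i) ≡⟨ cong (Fin.join a b) (f-injective eq) ⟩
    Fin.join a b (Fin.splitAt a j) ≡⟨ Fin.join-splitAt a b j ⟩
    j                              ∎
  where open ≡-Reasoning

module _ {B k : ℕ} {p : ℕ → ℕ} (ps : FirstPrimesAbove B k p) where

  p-monotone : ∀ {i j} → i < j → j < k → p i < p j
  p-monotone {i} {suc j} (s≤s i≤j) 1+j<k with ℕ.m≤n⇒m<n∨m≡n i≤j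
  ... | inj₁ i<j  = ℕ.<-trans (p-monotone i<j (ℕ.<-trans (ℕ.n<1+n j) 1+j<k)) (incr ps j 1+j<k)
  ... | inj₂ refl = incr ps j 1+j<k

  p-injective : ∀ {i j} → i < k → j < k → p i ≡ p j → i ≡ j
  p-injective {i} {j} i<k j<k pi≡pj with ℕ.<-cmp i j
  ... | tri< i<j _ _ = contradiction pi≡pj (ℕ.<⇒≢ (p-monotone i<j j<k))
  ... | tri≈ _ i≡j _ = i≡j
  ... | tri> _ _ j<i = contradiction (sym pi≡pj) (ℕ.<⇒≢ (p-monotone j<i i<k))

negate : ∀ {n} → Literal n → Literal n
negate (i , b) = i , not b

_≟ₗ_ : ∀ {n} (y z : Literal n) → Dec (y ≡ z)
_≟ₗ_ = ≡-dec Fin._≟_ Bool._≟_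

≢-negateˡ : ∀ {n} {y z : Literal n} → (proj₁ y ≡ proj₁ z → proj₂ y ≡ proj₂ z) → y ≢ negate z
≢-negateˡ same-variable⇒same-sign refl = Bool.not-¬ (same-variable⇒same-sign refl) refl

≢-negateʳ : ∀ {n} {y z : Literal n} → (proj₁ y ≡ proj₁ z → proj₂ y ≡ proj₂ z) → z ≢ negate y
≢-negateʳ same-variable⇒same-sign refl = Bool.not-¬ refl (same-variable⇒same-sign refl)

literalIndex : ∀ {n} → Literal n → Fin (n * 2)
literalIndex (i , true)  = combine i Fin.zero
literalIndex (i , false) = combine i (Fin.suc Fin.zero)

module _ {n : ℕ} where

  rep₁≡p∘literalIndex : ∀ p (y : Literal n) → rep₁ p y ≡ p (toℕ (literalIndex y))
  rep₁≡p∘literalIndex p (i , true)  = cong p (sym (trans (Fin.toℕ-combine i Fin.zero) (ℕ.+-identityʳ _)))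
  rep₁≡p∘literalIndex p (i , false) = cong p (sym (trans (Fin.toℕ-combine i (Fin.suc Fin.zero)) (ℕ.+-comm _ 1)))

  literalIndex-injective : Injective _≡_ _≡_ (literalIndex {n})
  literalIndex-injective {i , true}  {j , true}  eq = cong (_, true) (proj₁ (Fin.combine-injective i _ j _ eq))
  literalIndex-injective {i , false} {j , false} eq = cong (_, false) (proj₁ (Fin.combine-injective i _ j _ eq))
  literalIndex-injective {i , true}  {j , false} eq with () ← proj₂ (Fin.combine-injective i _ j _ eq)
  literalIndex-injective {i , false} {j , true}  eq with () ← proj₂ (Fin.combine-injective i _ j _ eq)

  literalIndex-surjective : ∀ l → ∃ λ y → literalIndex {n} y ≡ l
  literalIndex-surjective l with Fin.combine-surjective {n} l
  ... | i , Fin.zero , eq                = (i , true) , eq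
  ... | i , Fin.suc Fin.zero , eq        = (i , false) , eq

  module Primes {B : ℕ} {p : ℕ → ℕ} (ps : FirstPrimesAbove B (2 * n) p) where

    private
      index<2n : ∀ (y : Literal n) → toℕ (literalIndex y) < 2 * n
      index<2n y = subst (toℕ (literalIndex y) <_) (ℕ.*-comm n 2) (Fin.toℕ<n (literalIndex y))

    rep₁-prime : ∀ (y : Literal n) → Prime (rep₁ p y)
    rep₁-prime y = subst Prime (sym (rep₁≡p∘literalIndex p y)) (prime ps _ (index<2n y))

    rep₁>1 : ∀ (y : Literal n) → 1 < rep₁ p y
    rep₁>1 y = ℕ.nonTrivial⇒n>1 (rep₁ p y) {{prime⇒nonTrivial (rep₁-prime y)}}

    rep₁>0 : ∀ (y : Literal n) → 0 < rep₁ p y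
    rep₁>0 y = ℕ.<-trans ℕ.z<s (rep₁>1 y)

    rep₁-injective : Injective _≡_ _≡_ (rep₁ {n} p)
    rep₁-injective {y} {z} eq = literalIndex-injective (Fin.toℕ-injective
      (p-injective ps (index<2n y) (index<2n z)
        (trans (sym (rep₁≡p∘literalIndex p y)) (trans eq (rep₁≡p∘literalIndex p z)))))

    rep₁-coprime : ∀ {y z : Literal n} → y ≢ z → Coprime (rep₁ p y) (rep₁ p z)
    rep₁-coprime {y} {z} y≢z = primes-coprime (rep₁-prime y) (rep₁-prime z) (y≢z ∘ rep₁-injective)

module _ {A : Set} where

  position : ∀ {xs ys : List A} → xs ⊆ ys → Fin (length xs) → Fin (length ys)
  position (y ∷ʳ τ) i                = Fin.suc (position τ i)
  position (refl ∷ τ) Fin.zero       = Fin.zero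
  position (refl ∷ τ) (Fin.suc i)    = Fin.suc (position τ i)

  position-injective : ∀ {xs ys : List A} (τ : xs ⊆ ys) → Injective _≡_ _≡_ (position τ)
  position-injective (y ∷ʳ τ)   eq = position-injective τ (Fin.suc-injective eq)
  position-injective (refl ∷ τ) {Fin.zero}  {Fin.zero}  eq = refl
  position-injective (refl ∷ τ) {Fin.suc i} {Fin.suc j} eq = cong Fin.suc (position-injective τ (Fin.suc-injective eq))

  lookup-position : ∀ {xs ys : List A} (τ : xs ⊆ ys) i → lookup ys (position τ i) ≡ lookup xs i
  lookup-position (y ∷ʳ τ)   i           = lookup-position τ i
  lookup-position (refl ∷ τ) Fin.zero    = refl
  lookup-position (refl ∷ τ) (Fin.suc i) = lookup-position τ i

  ⊆-concatMap : ∀ {B : Set} (f : B → List A) {x xs} → x ∈ xs → f x ⊆ concatMap f xs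
  ⊆-concatMap f {xs = x ∷ xs} (here refl) = ++⁺ʳ (concatMap f xs) ⊆-refl
  ⊆-concatMap f {xs = x ∷ xs} (there x∈xs) = ++⁺ˡ (f x) (⊆-concatMap f x∈xs)

∈-allLiterals : ∀ {n} (y : Literal n) → y ∈ allLiterals n
∈-allLiterals (i , b) = ∈-concatMap⁺ _ (Any.map (λ { refl → lit∈ b }) (∈-allFin i))
  where
  lit∈ : ∀ b → (i , b) ∈ (i , true) ∷ (i , false) ∷ []
  lit∈ true  = here refl
  lit∈ false = there (here refl)

module Tasks {n m : ℕ} (p : ℕ → ℕ) (C : Instance n m) where

  tasks : List ℕ
  tasks = redEPS p C

  Task : Set
  Task = Fin (length tasks)

  rep : Literal n → ℕ
  rep = rep₁ p

  copyCount : Literal n → ℕ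
  copyCount y = rep y * rep y ∸ rep y

  clauseRep : Fin m → ℕ
  clauseRep j = rep (c₁ (C j)) * rep (c₂ (C j)) * rep (c₃ (C j))

  private
    literalPeriods : Literal n → List ℕ
    literalPeriods y = replicate (copyCount y) (2 * n * (rep y * rep y))

    variablePeriod : Fin n → ℕ
    variablePeriod i = 2 * n * (rep (i , true) * rep (i , false))

    clausePeriod : Fin m → ℕ
    clausePeriod j = 2 * n * (clauseRep j * clauseRep j)

    literalPart variablePart clausePart : List ℕ
    literalPart = concatMap literalPeriods (allLiterals n)
    variablePart = map variablePeriod (allFin n)
    clausePart = map clausePeriod (allFin m)

    literalPeriods⊆tasks : ∀ y → literalPeriods y ⊆ tasks
    literalPeriods⊆tasks y = ++⁺ʳ (variablePart ++ clausePart) (⊆-concatMap literalPeriods (∈-allLiterals y))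

    variablePeriod⊆tasks : ∀ i → variablePeriod i ∷ [] ⊆ tasks
    variablePeriod⊆tasks i = ++⁺ˡ literalPart (++⁺ʳ clausePart (from∈ (∈-map⁺ variablePeriod (∈-allFin i))))

    clausePeriod⊆tasks : ∀ j → clausePeriod j ∷ [] ⊆ tasks
    clausePeriod⊆tasks j = ++⁺ˡ literalPart (++⁺ˡ variablePart (from∈ (∈-map⁺ clausePeriod (∈-allFin j))))

  -- Opaque: unfolding these positions into the concrete list makes type checking very slow.
  opaque
    copy : ∀ y → Fin (copyCount y) → Task
    copy y k = position (literalPeriods⊆tasks y) (Fin.cast (sym (length-replicate (copyCount y))) k)

    copy-injective : ∀ y → Injective _≡_ _≡_ (copy y)
    copy-injective y {k} {k′} eq = Fin.toℕ-injective (begin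
      toℕ k                      ≡⟨ Fin.toℕ-cast _ k ⟨
      toℕ (Fin.cast _ k)         ≡⟨ cong toℕ (position-injective (literalPeriods⊆tasks y) eq) ⟩
      toℕ (Fin.cast _ k′)        ≡⟨ Fin.toℕ-cast _ k′ ⟩
      toℕ k′                     ∎)
      where open ≡-Reasoning

    copy-period : ∀ y k → lookup tasks (copy y k) ≡ 2 * n * (rep y * rep y)
    copy-period y k = trans (lookup-position (literalPeriods⊆tasks y) _) (lookup-replicate (copyCount y) _ k)

    variableTask : Fin n → Task
    variableTask i = position (variablePeriod⊆tasks i) Fin.zero

    variableTask-period : ∀ i → lookup tasks (variableTask i) ≡ 2 * n * (rep (i , true) * rep (i , false))
    variableTask-period i = lookup-position (variablePeriod⊆tasks i) Fin.zero

    clauseTask : Fin m → Task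
    clauseTask j = position (clausePeriod⊆tasks j) Fin.zero

    clauseTask-period : ∀ j → lookup tasks (clauseTask j) ≡ 2 * n * (clauseRep j * clauseRep j)
    clauseTask-period j = lookup-position (clausePeriod⊆tasks j) Fin.zero

  variableTask-period-literal : ∀ y → lookup tasks (variableTask (proj₁ y)) ≡ 2 * n * rep y * rep (negate y)
  variableTask-period-literal (i , true)  = trans (variableTask-period i) (sym (ℕ.*-assoc (2 * n) _ _))
  variableTask-period-literal (i , false) = trans (variableTask-period i) (x∙yz≈xz∙y (2 * n) _ _)

module Schedule {L : List ℕ} {σ : ℤ → Maybe (Fin (length L))} (schedule : IsEPSSchedule L σ) where

  period : Fin (length L) → ℕ
  period = lookup L

  occurs-+ : ∀ {t i} → σ t ≡ just i → ∀ k → σ (t ℤ.+ + (k * period i)) ≡ just i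
  occurs-+ {t} {i} σt≡i zero    = subst (λ s → σ s ≡ just i) (sym (ℤ.+-identityʳ t)) σt≡i
  occurs-+ {t} {i} σt≡i (suc k) = subst (λ s → σ s ≡ just i) t+kp+p≡t+[1+k]p
    (proj₁ (proj₂ (schedule i) _ (occurs-+ σt≡i k)))
    where
    t+kp+p≡t+[1+k]p : t ℤ.+ + (k * period i) ℤ.+ + period i ≡ t ℤ.+ + (suc k * period i)
    t+kp+p≡t+[1+k]p = trans (ℤ.+-assoc t _ _) (cong (λ s → t ℤ.+ + s) (ℕ.+-comm (k * period i) (period i)))

  opaque
    -- The given occurrence t moved forward by ∣ t ∣ periods (junk if period i ≡ 0).
    start : Fin (length L) → ℕ
    start i with proj₁ (proj₁ (schedule i))
    ... | + s      = s
    ... | -[1+ s ] = suc s * period i ∸ suc s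

    start-occurs : ∀ i → 0 < period i → σ (+ start i) ≡ just i
    start-occurs i p>0 with proj₁ (proj₁ (schedule i)) | proj₂ (proj₁ (schedule i))
    ... | + s      | σs≡i = σs≡i
    ... | -[1+ s ] | σt≡i = subst (λ t → σ t ≡ just i) (ℤ.⊖-≥ s+1≤[s+1]p) (occurs-+ σt≡i (suc s))
      where
      s+1≤[s+1]p : suc s ≤ suc s * period i
      s+1≤[s+1]p = subst (_≤ suc s * period i) (ℕ.*-identityʳ (suc s)) (ℕ.*-monoʳ-≤ (suc s) p>0)

  module _ {g : ℕ} .{{_ : NonZero g}} where

    collision : ∀ {X Z u v} → period X ≡ g * u → period Z ≡ g * v → Coprime u v → 0 < u → 0 < v →
                start X % g ≡ start Z % g → X ≡ Z
    collision {X} {Z} {u} {v} pX≡gu pZ≡gv u⊥v u>0 v>0 sX≡sZ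
      with k , l , meet ← %≡%⇒progressions-meet u⊥v u>0 v>0 sX≡sZ =
      just-injective (begin
        just X                                ≡⟨ occurs X u pX≡gu u>0 k ⟨
        σ (+ (start X + k * (g * u)))         ≡⟨ cong (σ ∘ +_) meet ⟩
        σ (+ (start Z + l * (g * v)))         ≡⟨ occurs Z v pZ≡gv v>0 l ⟩
        just Z                                ∎)
      where
      open ≡-Reasoning
      occurs : ∀ Y w → period Y ≡ g * w → 0 < w → ∀ k → σ (+ (start Y + k * (g * w))) ≡ just Y
      occurs Y w pY≡gw w>0 k = subst (λ q → σ (+ (start Y + k * q)) ≡ just Y) pY≡gw
        (occurs-+ (start-occurs Y (subst (0 <_) (sym pY≡gw) (*-positive (ℕ.>-nonZero⁻¹ g) w>0))) k)

    no-collision : ∀ {X Z u v} → period X ≡ g * u → period Z ≡ g * v → Coprime u v → 1 < u → 0 < v →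
                   start X % g ≢ start Z % g
    no-collision {X} {Z} {u} {v} pX≡gu pZ≡gv u⊥v 1<u v>0 sX≡sZ
      with refl ← collision pX≡gu pZ≡gv u⊥v (ℕ.<-trans ℕ.z<s 1<u) v>0 sX≡sZ
      with refl ← ℕ.*-cancelˡ-≡ u v g (trans (sym pX≡gu) pZ≡gv)
      = ℕ.<⇒≢ 1<u (sym (u⊥v (∣-refl , ∣-refl)))

module Reduction {n m : ℕ} .{{_ : NonZero n}} (C : Instance n m) {p : ℕ → ℕ}
                 (ps : FirstPrimesAbove (m ⊔ n) (2 * n) p)
                 {σ} (schedule : IsEPSSchedule (redEPS p C) σ) where

  open Tasks p C
  open Schedule {tasks} {σ} schedule
  open Primes {n} ps

  N : ℕ
  N = 2 * n

  instance
    N≢0 : NonZero N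
    N≢0 = ℕ.m*n≢0 2 n

  -- Opaque for the same reason as in Tasks.
  opaque
    representative : Literal n → Task
    representative y =
      copy y (Fin.fromℕ< (ℕ.m<n⇒0<n∸m (ℕ.m<m*n (rep y) (rep y) {{ℕ.>-nonZero (rep₁>0 y)}} (rep₁>1 y))))

    representative-period : ∀ y → period (representative y) ≡ N * (rep y * rep y)
    representative-period y = copy-period y _

  Class : Task → Literal n → Set
  Class X y = start X % N ≡ start (representative y) % N

  same-class⇒same-literal : ∀ {X Z y z} → period X ≡ N * (rep y * rep y) → period Z ≡ N * (rep z * rep z) →
                            start X % N ≡ start Z % N → y ≡ z
  same-class⇒same-literal {y = y} {z} pX pZ sX≡sZ with y ≟ₗ z
  ... | yes y≡z = y≡z
  ... | no  y≢z = ⊥-elim (no-collision {N} pX pZ (coprime-squares (rep₁-coprime y≢z))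
                    (*-nontrivial (rep₁>1 y) (rep₁>0 y)) (*-positive (rep₁>0 z) (rep₁>0 z)) sX≡sZ)

  private
    toℕ-mod : ∀ x → toℕ (x mod N) ≡ x % N
    toℕ-mod x = Fin.toℕ-fromℕ< _

  literalClass : Literal n → Fin N
  literalClass y = start (representative y) mod N

  literalClass-injective : Injective _≡_ _≡_ literalClass
  literalClass-injective {y} {z} eq = same-class⇒same-literal (representative-period y) (representative-period z)
    (trans (sym (toℕ-mod _)) (trans (cong toℕ eq) (toℕ-mod _)))

  some-literal-class : ∀ X → ∃ (Class X)
  some-literal-class X
    with y , eq ← injective⇒surjective-via literalIndex literalIndex-surjective literalClass
                    literalClass-injective (ℕ.≤-reflexive (ℕ.*-comm 2 n)) (start X mod N)
    = y , trans (sym (toℕ-mod (start X))) (trans (cong toℕ (sym eq)) (toℕ-mod _))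

  in-class? : ∀ X y → Dec (Class X y)
  in-class? X y = start X % N ℕ.≟ start (representative y) % N

  copy-class : ∀ y k → Class (copy y k) y
  copy-class y k with z , eq ← some-literal-class (copy y k) =
    subst (Class (copy y k)) (sym (same-class⇒same-literal (copy-period y k) (representative-period z) eq)) eq

  variable-class : ∀ i z → Class (variableTask i) z → proj₁ z ≡ i
  variable-class i z eq with proj₁ z Fin.≟ i
  ... | yes same-variable = same-variable
  ... | no  z∉i = ⊥-elim (no-collision {N} (representative-period z) (variableTask-period i)
                    (coprime-*ʳ (coprime-*ˡ (lit⊥ true) (lit⊥ true)) (coprime-*ˡ (lit⊥ false) (lit⊥ false)))
                    (*-nontrivial (rep₁>1 z) (rep₁>0 z))
                    (*-positive (rep₁>0 (i , true)) (rep₁>0 (i , false))) (sym eq))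
    where
    lit⊥ : ∀ b → Coprime (rep z) (rep (i , b))
    lit⊥ b = rep₁-coprime {z} {i , b} (z∉i ∘ cong proj₁)

  -- The variable task lies in the class of x_i or of ¬x_i; the literal it sits with is made false.
  α : Fin n → Bool
  α i = isYes (in-class? (variableTask i) (i , false))

  false-literal-class : ∀ y → litValue α y ≡ false → Class (variableTask (proj₁ y)) y
  false-literal-class (i , false) _ with in-class? (variableTask i) (i , false)
  ... | yes class[¬xᵢ] = class[¬xᵢ]
  false-literal-class (i , true)  _ with in-class? (variableTask i) (i , false)
  ... | no ¬class[¬xᵢ]
    with (i′ , b) , class[i′,b] ← some-literal-class (variableTask i)
    with refl ← variable-class i (i′ , b) class[i′,b]
    with b
  ... | true  = class[i′,b]
  ... | false = contradiction class[i′,b] ¬class[¬xᵢ]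


  module Overcrowded (y : Literal n) (w : ℕ) (K : Task)
                     (K-period : period K ≡ N * ((rep y * w) * (rep y * w)))
                     (1<w : 1 < w) (w⊥ȳ : Coprime w (rep (negate y)))
                     (K-class : Class K y) (F-class : Class (variableTask (proj₁ y)) y) where

    private
      r s R : ℕ
      r = rep y
      s = rep (negate y)
      R = r * r

      F : Task
      F = variableTask (proj₁ y)

      instance
        r≢0 : NonZero r
        r≢0 = ℕ.>-nonZero (rep₁>0 y)
        R≢0 : NonZero R
        R≢0 = ℕ.m*n≢0 r r
        Nr≢0 : NonZero (N * r)
        Nr≢0 = ℕ.m*n≢0 N r
        RN≢0 : NonZero (R * N)
        RN≢0 = ℕ.m*n≢0 R N
        Nrr≢0 : NonZero (N * r * r)
        Nrr≢0 = ℕ.m*n≢0 (N * r) r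

      r⊥s : Coprime r s
      r⊥s = rep₁-coprime (≢-negateʳ {y = y} (λ _ → refl))

      w*w>0 : 0 < w * w
      w*w>0 = *-positive (ℕ.<-trans ℕ.z<s 1<w) (ℕ.<-trans ℕ.z<s 1<w)

      copy-period-R : ∀ k → period (copy y k) ≡ (R * N) * 1
      copy-period-R k = trans (copy-period y k) (shape N r)
        where
        shape : ∀ N r → N * (r * r) ≡ r * r * N * 1
        shape = solve-∀

      copy-period-r : ∀ k → period (copy y k) ≡ (N * r) * r
      copy-period-r k = trans (copy-period y k) (sym (ℕ.*-assoc N r r))

      K-period-R : period K ≡ (R * N) * (w * w)
      K-period-R = trans K-period (shape N r w)
        where
        shape : ∀ N r w → N * ((r * w) * (r * w)) ≡ r * r * N * (w * w)
        shape = solve-∀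

      K-period-r : period K ≡ (N * r) * (r * (w * w))
      K-period-r = trans K-period (shape N r w)
        where
        shape : ∀ N r w → N * ((r * w) * (r * w)) ≡ N * r * (r * (w * w))
        shape = solve-∀

      F-period : period F ≡ (N * r) * s
      F-period = variableTask-period-literal y

      Item : Set
      Item = Fin (copyCount y) ⊎ Fin (suc r)

      -- The shifts of start F by multiples of N r are the r residues mod r²N blocked by F:
      -- a task of period N r u, u coprime to s, starting ≡ start F (mod N r) would meet F.
      time : Item → ℕ
      time (inj₁ k)             = start (copy y k)
      time (inj₂ Fin.zero)      = start K
      time (inj₂ (Fin.suc j))   = start F + toℕ j * (N * r)

      time-class : ∀ i → time i % N ≡ start (representative y) % N
      time-class (inj₁ k)           = copy-class y k
      time-class (inj₂ Fin.zero)    = K-class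
      time-class (inj₂ (Fin.suc j)) =
        trans (%≡%⇒%≡%-∣ {N} {N * r} (m∣m*n r) ([m+kn]%n≡m%n (start F) (toℕ j) (N * r))) F-class

      slot : Item → Fin R
      slot i = (time i / N) mod R

      same-slot : ∀ i i′ → slot i ≡ slot i′ → time i % (R * N) ≡ time i′ % (R * N)
      same-slot i i′ eq = %≡%∧/%≡/%⇒%≡% {N} {R} (trans (time-class i) (sym (time-class i′)))
        (trans (sym (Fin.toℕ-fromℕ< _)) (trans (cong toℕ eq) (Fin.toℕ-fromℕ< _)))

      F-shift : ∀ {x} j → x % (R * N) ≡ time (inj₂ (Fin.suc j)) % (R * N) → x % (N * r) ≡ start F % (N * r)
      F-shift j eq = trans (%≡%⇒%≡%-∣ Nr∣RN eq) ([m+kn]%n≡m%n (start F) (toℕ j) (N * r))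
        where
        shape : ∀ N r → r * r * N ≡ r * (N * r)
        shape = solve-∀
        Nr∣RN : N * r ∣ R * N
        Nr∣RN = divides r (shape N r)

      copy≁K : ∀ k → time (inj₁ k) % (R * N) ≢ time (inj₂ Fin.zero) % (R * N)
      copy≁K k eq = no-collision {R * N} K-period-R (copy-period-R k) (Coprime.sym (Coprime.1-coprimeTo (w * w)))
        (*-nontrivial 1<w (ℕ.<-trans ℕ.z<s 1<w)) ℕ.z<s (sym eq)

      copy≁F : ∀ k j → time (inj₁ k) % (R * N) ≢ time (inj₂ (Fin.suc j)) % (R * N)
      copy≁F k j eq = no-collision {N * r} F-period (copy-period-r k) (Coprime.sym r⊥s)
        (rep₁>1 (negate y)) (rep₁>0 y) (sym (F-shift j eq))

      K≁F : ∀ j → time (inj₂ Fin.zero) % (R * N) ≢ time (inj₂ (Fin.suc j)) % (R * N)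
      K≁F j eq = no-collision {N * r} K-period-r F-period (coprime-*ˡ r⊥s (coprime-*ˡ w⊥ȳ w⊥ȳ))
        (*-nontrivial (rep₁>1 y) w*w>0) (rep₁>0 (negate y)) (F-shift j eq)

      F-shift-injective : ∀ j j′ → time (inj₂ (Fin.suc j)) % (R * N) ≡ time (inj₂ (Fin.suc j′)) % (R * N) →
                          j ≡ j′
      F-shift-injective j j′ eq = Fin.toℕ-injective (+-*-%-injective {N * r} {r} (Fin.toℕ<n j) (Fin.toℕ<n j′)
        (%≡%⇒%≡%-∣ (∣-reflexive (shape N r)) eq))
        where
        shape : ∀ N r → N * r * r ≡ r * r * N
        shape = solve-∀

      time-injective : ∀ i i′ → time i % (R * N) ≡ time i′ % (R * N) → i ≡ i′
      time-injective (inj₁ k)           (inj₁ k′)           eq = cong inj₁ (copy-injective y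
        (collision {R * N} (copy-period-R k) (copy-period-R k′) (Coprime.1-coprimeTo 1) ℕ.z<s ℕ.z<s eq))
      time-injective (inj₁ k)           (inj₂ Fin.zero)     eq = ⊥-elim (copy≁K k eq)
      time-injective (inj₂ Fin.zero)    (inj₁ k)            eq = ⊥-elim (copy≁K k (sym eq))
      time-injective (inj₁ k)           (inj₂ (Fin.suc j))  eq = ⊥-elim (copy≁F k j eq)
      time-injective (inj₂ (Fin.suc j)) (inj₁ k)            eq = ⊥-elim (copy≁F k j (sym eq))
      time-injective (inj₂ Fin.zero)    (inj₂ Fin.zero)     eq = refl
      time-injective (inj₂ Fin.zero)    (inj₂ (Fin.suc j))  eq = ⊥-elim (K≁F j eq)
      time-injective (inj₂ (Fin.suc j)) (inj₂ Fin.zero)     eq = ⊥-elim (K≁F j (sym eq))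
      time-injective (inj₂ (Fin.suc j)) (inj₂ (Fin.suc j′)) eq =
        cong (inj₂ ∘ Fin.suc) (F-shift-injective j j′ eq)

      slot-injective : Injective _≡_ _≡_ slot
      slot-injective {i} {i′} eq = time-injective i i′ (same-slot i i′ eq)

      R<items : R < copyCount y + suc r
      R<items = ℕ.≤-reflexive (sym (trans (ℕ.+-suc (R ∸ r) r) (cong suc (ℕ.m∸n+n≡m (ℕ.m≤m*n r r)))))

    overcrowded : ⊥
    overcrowded = ⊎-<⇒notInjective {f = slot} R<items slot-injective

  heavy-class⇒true : ∀ y w K → period K ≡ N * ((rep y * w) * (rep y * w)) → 1 < w →
                     Coprime w (rep (negate y)) → Class K y → T (litValue α y)
  heavy-class⇒true y w K K-period 1<w w⊥ȳ K-class with litValue α y in y-value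
  ... | true  = tt
  ... | false = Overcrowded.overcrowded y w K K-period 1<w w⊥ȳ K-class (false-literal-class y y-value)

  clause-literal-true : ∀ j y a b → clauseRep j ≡ rep y * (rep a * rep b) → a ≢ negate y → b ≢ negate y →
                        Class (clauseTask j) y → T (litValue α y)
  clause-literal-true j y a b q≡ a≢ȳ b≢ȳ = heavy-class⇒true y (rep a * rep b) (clauseTask j)
    (trans (clauseTask-period j) (cong (λ q → N * (q * q)) q≡))
    (*-nontrivial (rep₁>1 a) (rep₁>0 b))
    (coprime-*ˡ (rep₁-coprime a≢ȳ) (rep₁-coprime b≢ȳ))

  private
    r₁ r₂ r₃ : Fin m → ℕ
    r₁ j = rep (c₁ (C j))
    r₂ j = rep (c₂ (C j))
    r₃ j = rep (c₃ (C j))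

  clause-class-satisfied : ∀ j z → Class (clauseTask j) z → ClauseSat α (C j)
  clause-class-satisfied j z z-class with z ≟ₗ c₁ (C j) | z ≟ₗ c₂ (C j) | z ≟ₗ c₃ (C j)
  ... | yes refl | _ | _ = inj₁ (clause-literal-true j z (c₂ (C j)) (c₃ (C j))
    (ℕ.*-assoc (r₁ j) (r₂ j) (r₃ j))
    (≢-negateʳ (noCompl₁₂ (C j))) (≢-negateʳ (noCompl₁₃ (C j))) z-class)
  ... | no _ | yes refl | _ = inj₂ (inj₁ (clause-literal-true j z (c₁ (C j)) (c₃ (C j))
    (xy∙z≈y∙xz (r₁ j) (r₂ j) (r₃ j))
    (≢-negateˡ (noCompl₁₂ (C j))) (≢-negateʳ (noCompl₂₃ (C j))) z-class))
  ... | no _ | no _ | yes refl = inj₂ (inj₂ (clause-literal-true j z (c₁ (C j)) (c₂ (C j))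
    (xy∙z≈z∙xy (r₁ j) (r₂ j) (r₃ j))
    (≢-negateˡ (noCompl₁₃ (C j))) (≢-negateˡ (noCompl₂₃ (C j))) z-class))
  ... | no z≢c₁ | no z≢c₂ | no z≢c₃ = ⊥-elim (no-collision {N} (clauseTask-period j) (representative-period z)
    (coprime-squares (coprime-*ˡ (coprime-*ˡ (c⊥z z≢c₁) (c⊥z z≢c₂)) (c⊥z z≢c₃)))
    (*-nontrivial q>1 (ℕ.<-trans ℕ.z<s q>1)) (*-positive (rep₁>0 z) (rep₁>0 z)) z-class)
    where
    c⊥z : ∀ {c} → z ≢ c → Coprime (rep c) (rep z)
    c⊥z z≢c = rep₁-coprime (z≢c ∘ sym)
    q>1 : 1 < clauseRep j
    q>1 = *-nontrivial (*-nontrivial (rep₁>1 (c₁ (C j))) (rep₁>0 (c₂ (C j)))) (rep₁>0 (c₃ (C j)))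

  clause-satisfied : ∀ j → ClauseSat α (C j)
  clause-satisfied j = clause-class-satisfied j _ (proj₂ (some-literal-class (clauseTask j)))

lemma9 : (n m : ℕ) (C : Instance n m) (p : ℕ → ℕ) →
         FirstPrimesAbove (m ⊔ n) (2 * n) p →
         HasEPSSchedule (redEPS p C) →
         Satisfiable C
lemma9 zero    zero    C p _  _              = (λ ()) , (λ ())
lemma9 zero    (suc m) C p _  _              with () ← proj₁ (c₁ (C Fin.zero))
lemma9 (suc n) m       C p ps (σ , schedule) = α , clause-satisfied
  where open Reduction C ps schedule
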